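{- Let $n_1,\ldots,n_M\ge1$, $k\in[M]$, $j\in\mathbb{Z}^+$, and for each $\ell\in[j]$ let $\mathcal{T}_\ell$ be a $k$-dimensional multi-transversal on $\pi_M$ with parameters $\{L^{(\ell)}_P:P\in\binom{[M]}{k}\}$. Let $\alpha_1,\ldots,\alpha_j$ be positive reals such that for all $v\in\pi_M$ the number $\sum_{\ell=1}^j\alpha_\ell\#[v,\mathcal{T}_\ell]$ is an integer, and let $\mathcal{T}^\star$ be the multiset on $\pi_M$ in which each $v$ has multiplicity $\sum_{\ell=1}^j\alpha_\ell\#[v,\mathcal{T}_\ell]$. (i) Then $\mathcal{T}^\star$ is a $k$-dimensional multi-transversal on $\pi_M$ with parameters $L^\star_P=\lfloor\sum_{\ell=1}^j\alpha_\ell L^{(\ell)}_P\rfloor$. (ii) If moreover each $\mathcal{T}_\ell$ is full and there is a common $A\in\binom{[M]}{k}$ such that for all $\ell\in[j]$, $L^{(\ell)}_A\prod_{i\notin A}n_i=\min_{P}\big(L^{(\ell)}_P\prod_{i\notin P}n_i\big)$, then $\mathcal{T}^\star$ is full as well.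
   Context: $[n]^{\star}=\{0,\ldots,n-1\}$, $\pi_M=\prod_i[n_i]^{\star}$; $\#[v,\mathcal{T}]$ is the multiplicity of $v$ in the multiset $\mathcal{T}$. A $k$-dimensional multi-transversal on $\pi_M$ with parameters $\{L_P\}$ is a multiset $\mathcal{T}$ on $\pi_M$ such that for every $P\in\binom{[M]}{k}$ and every choice of $b_i\in[n_i]^{\star}$ ($i\notin P$), the number of elements (with multiplicity) with $i$-th coordinate $b_i$ for all $i\notin P$ is at most $L_P$. It is full if $|\mathcal{T}|$ (with multiplicity) equals $L_P\prod_{i\notin P}n_i$ for at least one $P$. -}

module Defs where

open import Level using (Level; _⊔_)
open import Data.Nat as ℕ using (ℕ; zero; suc)
open import Data.Integer as ℤ using (ℤ; +_; -[1+_])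
open import Data.Fin using (Fin; zero; suc; _≟_)
open import Data.Fin.Subset using (Subset; _∈_; _∉_; ∣_∣)
open import Data.Fin.Subset.Properties using (_∈?_)
open import Data.Product using (Σ; _×_; ∃; ∃-syntax)
open import Relation.Nullary using (¬_; yes; no)
open import Relation.Binary.PropositionalEquality using (_≡_)
open import Relation.Binary.Structures using (IsTotalOrder)
open import Algebra.Bundles using (CommutativeRing)

sumFin : (m : ℕ) → (Fin m → ℕ) → ℕ
sumFin zero    f = 0
sumFin (suc m) f = f zero ℕ.+ sumFin m (λ i → f (suc i))

prodFin : (m : ℕ) → (Fin m → ℕ) → ℕ
prodFin zero    f = 1
prodFin (suc m) f = f zero ℕ.* prodFin m (λ i → f (suc i))

-- The grid π_M = ∏_i [n_i]^⋆ : a point is a dependent function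
-- v : (i : Fin M) → Fin (n i)   (coordinate i lies in {0,…,n_i - 1}).

Point : (M : ℕ) → (Fin M → ℕ) → Set
Point M n = (i : Fin M) → Fin (n i)

sumPts : (M : ℕ) (n : Fin M → ℕ) → (Point M n → ℕ) → ℕ
sumPts zero    n f = f (λ ())
sumPts (suc M) n f =
  sumFin (n zero) (λ x → sumPts M (λ i → n (suc i))
    (λ v → f (λ { zero → x ; (suc i) → v i })))

-- A multiset on π_M is its multiplicity function v ↦ #[v,T].
Multiset : (M : ℕ) → (Fin M → ℕ) → Set
Multiset M n = Point M n → ℕ

size : {M : ℕ} {n : Fin M → ℕ} → Multiset M n → ℕ
size {M} {n} T = sumPts M n T

prodOut : {M : ℕ} (n : Fin M → ℕ) → Subset M → ℕ
prodOut {M} n P = prodFin M (λ i → f i (i ∈? P))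
  where
  f : ∀ i → _ → ℕ
  f i (yes _) = 1
  f i (no _)  = n i

-- Number of elements of T (with multiplicity) whose i-th coordinate
-- equals b i for every i ∉ P.  (The coordinates of b at i ∈ P are ignored.)
fiberCount : {M : ℕ} {n : Fin M → ℕ} → Multiset M n → Subset M → Point M n → ℕ
fiberCount {M} {n} T P b = sumPts M n (λ v → T v ℕ.* prodFin M (λ i → agree v i (i ∈? P)))
  where
  agree : Point M n → ∀ i → _ → ℕ
  agree v i (yes _) = 1
  agree v i (no _)  with v i ≟ b i
  ... | yes _ = 1
  ... | no _  = 0

-- k-dimensional multi-transversal on π_M with parameters {L_P : P ∈ ([M] choose k)}.
-- Parameters are taken integer-valued (they are forced to be ≥ 0 anyway).
IsMultiTransversal : (M : ℕ) (n : Fin M → ℕ) (k : ℕ) → Multiset M n → (Subset M → ℤ) → Set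
IsMultiTransversal M n k T L =
  (P : Subset M) → ∣ P ∣ ≡ k → (b : Point M n) → (+ fiberCount T P b) ℤ.≤ L P

IsFull : (M : ℕ) (n : Fin M → ℕ) (k : ℕ) → Multiset M n → (Subset M → ℤ) → Set
IsFull M n k T L = ∃[ P ] (∣ P ∣ ≡ k × (+ size T) ≡ L P ℤ.* (+ prodOut n P))

-- Stand-in for the real numbers: an arbitrary totally ordered commutative
-- ring with a floor function.  (ℝ is such a structure.)

module RingOps {c ℓ} (R : CommutativeRing c ℓ) where
  open CommutativeRing R hiding (zero)

  fromℕ : ℕ → Carrier
  fromℕ zero    = 0#
  fromℕ (suc m) = 1# + fromℕ m

  fromℤ : ℤ → Carrier
  fromℤ (+ m)      = fromℕ m
  fromℤ -[1+ m ]   = - fromℕ (suc m)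

  sumR : (j : ℕ) → (Fin j → Carrier) → Carrier
  sumR zero    f = 0#
  sumR (suc j) f = f zero + sumR j (λ i → f (suc i))

record FloorOrder {c ℓ} (R : CommutativeRing c ℓ) (ℓ₂ : Level) : Set (c ⊔ ℓ ⊔ Level.suc ℓ₂) where
  open CommutativeRing R hiding (zero)
  open RingOps R
  field
    _≤_        : Carrier → Carrier → Set ℓ₂
    isTotalOrder : IsTotalOrder _≈_ _≤_
    +-mono-≤   : ∀ {x y} z → x ≤ y → (x + z) ≤ (y + z)
    *-nonneg   : ∀ {x y} → 0# ≤ x → 0# ≤ y → 0# ≤ (x * y)
    ⌊_⌋        : Carrier → ℤ
    ⌊⌋-≤       : ∀ x → fromℤ ⌊ x ⌋ ≤ x
    <-⌊⌋+1     : ∀ x → x ≤ fromℤ (⌊ x ⌋ ℤ.+ ℤ.1ℤ) × ¬ (x ≈ fromℤ (⌊ x ⌋ ℤ.+ ℤ.1ℤ))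

  _<_ : Carrier → Carrier → Set (ℓ ⊔ ℓ₂)
  x < y = x ≤ y × ¬ (x ≈ y)

-- The argument has three parts.
--   * Fibre counts are linear in the multiset: a fibre count is a weighted sum
--     of multiplicities, so the combination hypothesis transfers from points to
--     fibres and to sizes (IsCombination, combination-sumPts).
--   * Part (i): each fibre of the combination is bounded by the combined
--     parameter, hence (being an integer) by its floor (floor-greatest).
--   * Part (ii): double counting over all fibres gives |T| ≤ L_Q ∏_{i∉Q} n_i;
--     a full transversal therefore attains this bound at the minimising A
--     (full-at-minimiser), so |T*| equals the combined parameter at A times
--     ∏_{i∉A} n_i, and an integer sandwiched as ⌊x⌋ p ≥ |T*| = x p ≥ ⌊x⌋ p
--     gives fullness (integral-sandwich).
module Submission where

open import Defs
open import Level using (Level)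
open import Function using (_∘_)
open import Data.Nat as ℕ using (ℕ; zero; suc; z≤n)
import Data.Nat.Properties as ℕP
open import Data.Integer as ℤ using (ℤ; +_)
import Data.Integer.Properties as ℤP
open import Data.Fin as Fin using (Fin; _≟_)
open import Data.Fin.Subset using (Subset; ∣_∣)
open import Data.Fin.Subset.Properties using (_∈?_)
open import Data.Product using (Σ; _×_; _,_; proj₁; proj₂)
open import Data.Sum using (inj₁; inj₂)
open import Data.Empty using (⊥-elim)
open import Relation.Nullary using (¬_; yes; no)
open import Relation.Binary.Bundles using (Poset)
open import Relation.Binary.Structures using (IsTotalOrder)
open import Relation.Binary.PropositionalEquality as ≡ using (_≡_; refl; cong; cong₂)
open import Algebra.Bundles using (CommutativeRing)
import Algebra.Properties.CommutativeSemigroup as CommutativeSemigroupProperties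
import Algebra.Properties.Ring as RingProperties

module FiniteSums where
  open ≡.≡-Reasoning

  +-interchange : ∀ a b c d → (a ℕ.+ b) ℕ.+ (c ℕ.+ d) ≡ (a ℕ.+ c) ℕ.+ (b ℕ.+ d)
  +-interchange = CommutativeSemigroupProperties.interchange ℕP.+-commutativeSemigroup

  sumFin-cong : ∀ m {f g : Fin m → ℕ} → (∀ x → f x ≡ g x) → sumFin m f ≡ sumFin m g
  sumFin-cong zero    f≗g = refl
  sumFin-cong (suc m) f≗g = cong₂ ℕ._+_ (f≗g Fin.zero) (sumFin-cong m (f≗g ∘ Fin.suc))

  sumFin-const : ∀ m a → sumFin m (λ _ → a) ≡ m ℕ.* a
  sumFin-const zero    a = refl
  sumFin-const (suc m) a = cong (a ℕ.+_) (sumFin-const m a)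

  sumFin-+ : ∀ m (f g : Fin m → ℕ) → sumFin m (λ x → f x ℕ.+ g x) ≡ sumFin m f ℕ.+ sumFin m g
  sumFin-+ zero    f g = refl
  sumFin-+ (suc m) f g = begin
    f Fin.zero ℕ.+ g Fin.zero ℕ.+ sumFin m (λ x → f (Fin.suc x) ℕ.+ g (Fin.suc x))
      ≡⟨ cong (f Fin.zero ℕ.+ g Fin.zero ℕ.+_) (sumFin-+ m (f ∘ Fin.suc) (g ∘ Fin.suc)) ⟩
    f Fin.zero ℕ.+ g Fin.zero ℕ.+ (sumFin m (f ∘ Fin.suc) ℕ.+ sumFin m (g ∘ Fin.suc))
      ≡⟨ +-interchange (f Fin.zero) (g Fin.zero) _ _ ⟩
    sumFin (suc m) f ℕ.+ sumFin (suc m) g ∎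

  sumFin-*ˡ : ∀ m c (f : Fin m → ℕ) → sumFin m (λ x → c ℕ.* f x) ≡ c ℕ.* sumFin m f
  sumFin-*ˡ zero    c f = ≡.sym (ℕP.*-zeroʳ c)
  sumFin-*ˡ (suc m) c f =
    ≡.trans (cong (c ℕ.* f Fin.zero ℕ.+_) (sumFin-*ˡ m c (f ∘ Fin.suc)))
            (≡.sym (ℕP.*-distribˡ-+ c _ _))

  sumFin-*ʳ : ∀ m c (f : Fin m → ℕ) → sumFin m (λ x → f x ℕ.* c) ≡ sumFin m f ℕ.* c
  sumFin-*ʳ m c f = begin
    sumFin m (λ x → f x ℕ.* c) ≡⟨ sumFin-cong m (λ x → ℕP.*-comm (f x) c) ⟩
    sumFin m (λ x → c ℕ.* f x) ≡⟨ sumFin-*ˡ m c f ⟩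
    c ℕ.* sumFin m f           ≡⟨ ℕP.*-comm c _ ⟩
    sumFin m f ℕ.* c           ∎

  sumFin-mono : ∀ m {f g : Fin m → ℕ} → (∀ x → f x ℕ.≤ g x) → sumFin m f ℕ.≤ sumFin m g
  sumFin-mono zero    f≤g = z≤n
  sumFin-mono (suc m) f≤g = ℕP.+-mono-≤ (f≤g Fin.zero) (sumFin-mono m (f≤g ∘ Fin.suc))

  δ : ∀ {m} → Fin m → Fin m → ℕ
  δ y x with y ≟ x
  ... | yes _ = 1
  ... | no  _ = 0

  δ-suc : ∀ {m} (y x : Fin m) → δ (Fin.suc y) (Fin.suc x) ≡ δ y x
  δ-suc y x with y ≟ x
  ... | yes _ = refl
  ... | no  _ = refl

  sumFin-δ : ∀ m (y : Fin m) → sumFin m (δ y) ≡ 1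
  sumFin-δ (suc m) Fin.zero    = cong suc (≡.trans (sumFin-const m 0) (ℕP.*-zeroʳ m))
  sumFin-δ (suc m) (Fin.suc y) = ≡.trans (sumFin-cong m (δ-suc y)) (sumFin-δ m y)

  prodFin-cong : ∀ m {f g : Fin m → ℕ} → (∀ x → f x ≡ g x) → prodFin m f ≡ prodFin m g
  prodFin-cong zero    f≗g = refl
  prodFin-cong (suc m) f≗g = cong₂ ℕ._*_ (f≗g Fin.zero) (prodFin-cong m (f≗g ∘ Fin.suc))

  prodFin-* : ∀ m (f g : Fin m → ℕ) → prodFin m (λ i → f i ℕ.* g i) ≡ prodFin m f ℕ.* prodFin m g
  prodFin-* zero    f g = refl
  prodFin-* (suc m) f g =
    ≡.trans (cong (f Fin.zero ℕ.* g Fin.zero ℕ.*_) (prodFin-* m (f ∘ Fin.suc) (g ∘ Fin.suc)))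
            (CommutativeSemigroupProperties.interchange ℕP.*-commutativeSemigroup
               (f Fin.zero) (g Fin.zero) _ _)

  prodFin-pos : ∀ m {f : Fin m → ℕ} → (∀ i → 1 ℕ.≤ f i) → 1 ℕ.≤ prodFin m f
  prodFin-pos zero    f≥1 = ℕP.≤-refl
  prodFin-pos (suc m) f≥1 = ℕP.*-mono-≤ (f≥1 Fin.zero) (prodFin-pos m (f≥1 ∘ Fin.suc))

  sumPts-cong : ∀ M (n : Fin M → ℕ) {f g : Point M n → ℕ} →
                (∀ v → f v ≡ g v) → sumPts M n f ≡ sumPts M n g
  sumPts-cong zero    n f≗g = f≗g _
  sumPts-cong (suc M) n f≗g =
    sumFin-cong (n Fin.zero) (λ x → sumPts-cong M (n ∘ Fin.suc) (λ v → f≗g _))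

  sumPts-const : ∀ M (n : Fin M → ℕ) c → sumPts M n (λ _ → c) ≡ prodFin M n ℕ.* c
  sumPts-const zero    n c = ≡.sym (ℕP.+-identityʳ c)
  sumPts-const (suc M) n c = begin
    sumFin (n Fin.zero) (λ _ → sumPts M (n ∘ Fin.suc) (λ _ → c))
      ≡⟨ sumFin-cong (n Fin.zero) (λ _ → sumPts-const M (n ∘ Fin.suc) c) ⟩
    sumFin (n Fin.zero) (λ _ → prodFin M (n ∘ Fin.suc) ℕ.* c)
      ≡⟨ sumFin-const (n Fin.zero) _ ⟩
    n Fin.zero ℕ.* (prodFin M (n ∘ Fin.suc) ℕ.* c)
      ≡⟨ ℕP.*-assoc (n Fin.zero) _ c ⟨
    prodFin (suc M) n ℕ.* c ∎

  sumPts-+ : ∀ M (n : Fin M → ℕ) (f g : Point M n → ℕ) →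
             sumPts M n (λ v → f v ℕ.+ g v) ≡ sumPts M n f ℕ.+ sumPts M n g
  sumPts-+ zero    n f g = refl
  sumPts-+ (suc M) n f g =
    ≡.trans (sumFin-cong (n Fin.zero) (λ x → sumPts-+ M (n ∘ Fin.suc) _ _))
            (sumFin-+ (n Fin.zero) _ _)

  sumPts-*ˡ : ∀ M (n : Fin M → ℕ) c (f : Point M n → ℕ) →
              sumPts M n (λ v → c ℕ.* f v) ≡ c ℕ.* sumPts M n f
  sumPts-*ˡ zero    n c f = refl
  sumPts-*ˡ (suc M) n c f =
    ≡.trans (sumFin-cong (n Fin.zero) (λ x → sumPts-*ˡ M (n ∘ Fin.suc) c _))
            (sumFin-*ˡ (n Fin.zero) c _)

  sumPts-*ʳ : ∀ M (n : Fin M → ℕ) c (f : Point M n → ℕ) →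
              sumPts M n (λ v → f v ℕ.* c) ≡ sumPts M n f ℕ.* c
  sumPts-*ʳ M n c f = begin
    sumPts M n (λ v → f v ℕ.* c) ≡⟨ sumPts-cong M n (λ v → ℕP.*-comm (f v) c) ⟩
    sumPts M n (λ v → c ℕ.* f v) ≡⟨ sumPts-*ˡ M n c f ⟩
    c ℕ.* sumPts M n f           ≡⟨ ℕP.*-comm c _ ⟩
    sumPts M n f ℕ.* c           ∎

  sumPts-mono : ∀ M (n : Fin M → ℕ) {f g : Point M n → ℕ} →
                (∀ v → f v ℕ.≤ g v) → sumPts M n f ℕ.≤ sumPts M n g
  sumPts-mono zero    n f≤g = f≤g _
  sumPts-mono (suc M) n f≤g =
    sumFin-mono (n Fin.zero) (λ x → sumPts-mono M (n ∘ Fin.suc) (λ v → f≤g _))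

  sumFin-sumPts-comm : ∀ m M (n : Fin M → ℕ) (G : Fin m → Point M n → ℕ) →
    sumFin m (λ x → sumPts M n (G x)) ≡ sumPts M n (λ v → sumFin m (λ x → G x v))
  sumFin-sumPts-comm zero    M n G =
    ≡.sym (≡.trans (sumPts-const M n 0) (ℕP.*-zeroʳ (prodFin M n)))
  sumFin-sumPts-comm (suc m) M n G =
    ≡.trans (cong (sumPts M n (G Fin.zero) ℕ.+_) (sumFin-sumPts-comm m M n (G ∘ Fin.suc)))
            (≡.sym (sumPts-+ M n _ _))

  sumPts-comm : ∀ M (n : Fin M → ℕ) M′ (n′ : Fin M′ → ℕ) (F : Point M n → Point M′ n′ → ℕ) →
    sumPts M n (λ b → sumPts M′ n′ (F b)) ≡ sumPts M′ n′ (λ v → sumPts M n (λ b → F b v))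
  sumPts-comm zero    n M′ n′ F = refl
  sumPts-comm (suc M) n M′ n′ F =
    ≡.trans (sumFin-cong (n Fin.zero) (λ x → sumPts-comm M (n ∘ Fin.suc) M′ n′ _))
            (sumFin-sumPts-comm (n Fin.zero) M′ n′ _)

  sumPts-prodFin : ∀ M (n : Fin M → ℕ) (g : (i : Fin M) → Fin (n i) → ℕ) →
    sumPts M n (λ b → prodFin M (λ i → g i (b i))) ≡ prodFin M (λ i → sumFin (n i) (g i))
  sumPts-prodFin zero    n g = refl
  sumPts-prodFin (suc M) n g =
    ≡.trans (sumFin-cong (n Fin.zero) factor) (sumFin-*ʳ (n Fin.zero) _ (g Fin.zero))
    where
    factor : ∀ x → sumPts M (n ∘ Fin.suc) (λ b → g Fin.zero x ℕ.* prodFin M (λ i → g (Fin.suc i) (b i)))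
                 ≡ g Fin.zero x ℕ.* prodFin M (λ i → sumFin (n (Fin.suc i)) (g (Fin.suc i)))
    factor x = ≡.trans (sumPts-*ˡ M (n ∘ Fin.suc) (g Fin.zero x) _)
                       (cong (g Fin.zero x ℕ.*_) (sumPts-prodFin M (n ∘ Fin.suc) (g ∘ Fin.suc)))

open FiniteSums

module Fibres {M : ℕ} {n : Fin M → ℕ} where
  open ≡.≡-Reasoning

  fibreIndicator : Subset M → Point M n → (i : Fin M) → Fin (n i) → ℕ
  fibreIndicator Q v i x with i ∈? Q
  ... | yes _ = 1
  ... | no  _ = δ (v i) x

  fibreWeight : Subset M → Point M n → Point M n → ℕ
  fibreWeight Q b v = prodFin M (λ i → fibreIndicator Q v i (b i))

  inSide : Subset M → Fin M → ℕ
  inSide Q i with i ∈? Q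
  ... | yes _ = n i
  ... | no  _ = 1

  outSide : Subset M → Fin M → ℕ
  outSide Q i with i ∈? Q
  ... | yes _ = 1
  ... | no  _ = n i

  side-split : ∀ Q i → n i ≡ inSide Q i ℕ.* outSide Q i
  side-split Q i with i ∈? Q
  ... | yes _ = ≡.sym (ℕP.*-identityʳ (n i))
  ... | no  _ = ≡.sym (ℕP.*-identityˡ (n i))

  inSide-pos : (∀ i → 1 ℕ.≤ n i) → ∀ Q i → 1 ℕ.≤ inSide Q i
  inSide-pos n≥1 Q i with i ∈? Q
  ... | yes _ = n≥1 i
  ... | no  _ = ℕP.≤-refl

  sumFin-fibreIndicator : ∀ Q v i → sumFin (n i) (fibreIndicator Q v i) ≡ inSide Q i
  sumFin-fibreIndicator Q v i with i ∈? Q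
  ... | yes _ = ≡.trans (sumFin-const (n i) 1) (ℕP.*-identityʳ (n i))
  ... | no  _ = sumFin-δ (n i) (v i)

  -- fiberCount and prodOut are built from local helpers of Defs that cannot be
  -- named; unification reads them off, and a case split identifies them.
  private
    fiberCount-exposed : ∀ T Q b → Σ (Point M n → Fin M → ℕ) λ w →
      fiberCount T Q b ≡ sumPts M n (λ v → T v ℕ.* prodFin M (w v))
    fiberCount-exposed T Q b = _ , refl

    exposed-indicator : ∀ T Q b v i →
      proj₁ (fiberCount-exposed T Q b) v i ≡ fibreIndicator Q v i (b i)
    exposed-indicator T Q b v i with i ∈? Q
    ... | yes _ = refl
    ... | no  _ with v i ≟ b i
    ...   | yes _ = refl
    ...   | no  _ = refl

    prodOut-exposed : ∀ Q → Σ (Fin M → ℕ) λ w → prodOut n Q ≡ prodFin M w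
    prodOut-exposed Q = _ , refl

    exposed-outSide : ∀ Q i → proj₁ (prodOut-exposed Q) i ≡ outSide Q i
    exposed-outSide Q i with i ∈? Q
    ... | yes _ = refl
    ... | no  _ = refl

  fiberCount-weighted : ∀ T Q b → fiberCount T Q b ≡ sumPts M n (λ v → T v ℕ.* fibreWeight Q b v)
  fiberCount-weighted T Q b =
    ≡.trans (proj₂ (fiberCount-exposed T Q b))
            (sumPts-cong M n (λ v → cong (T v ℕ.*_) (prodFin-cong M (exposed-indicator T Q b v))))

  prodOut-outSide : ∀ Q → prodOut n Q ≡ prodFin M (outSide Q)
  prodOut-outSide Q = ≡.trans (proj₂ (prodOut-exposed Q)) (prodFin-cong M (exposed-outSide Q))

  -- Double counting: every element lies in ∏_{i∈Q} n_i of the fibres.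
  sum-fiberCount : ∀ T Q → sumPts M n (fiberCount T Q) ≡ size T ℕ.* prodFin M (inSide Q)
  sum-fiberCount T Q = begin
    sumPts M n (fiberCount T Q)
      ≡⟨ sumPts-cong M n (fiberCount-weighted T Q) ⟩
    sumPts M n (λ b → sumPts M n (λ v → T v ℕ.* fibreWeight Q b v))
      ≡⟨ sumPts-comm M n M n _ ⟩
    sumPts M n (λ v → sumPts M n (λ b → T v ℕ.* fibreWeight Q b v))
      ≡⟨ sumPts-cong M n (λ v → sumPts-*ˡ M n (T v) _) ⟩
    sumPts M n (λ v → T v ℕ.* sumPts M n (λ b → fibreWeight Q b v))
      ≡⟨ sumPts-cong M n (λ v → cong (T v ℕ.*_) (fibres-through v)) ⟩
    sumPts M n (λ v → T v ℕ.* prodFin M (inSide Q))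
      ≡⟨ sumPts-*ʳ M n _ T ⟩
    size T ℕ.* prodFin M (inSide Q) ∎
    where
    fibres-through : ∀ v → sumPts M n (λ b → fibreWeight Q b v) ≡ prodFin M (inSide Q)
    fibres-through v = ≡.trans (sumPts-prodFin M n (fibreIndicator Q v))
                               (prodFin-cong M (sumFin-fibreIndicator Q v))

  size-bound : (∀ i → 1 ℕ.≤ n i) → ∀ T Q c →
               (∀ b → fiberCount T Q b ℕ.≤ c) → size T ℕ.≤ c ℕ.* prodOut n Q
  size-bound n≥1 T Q c fibre≤c =
    ≡.subst (λ p → size T ℕ.≤ c ℕ.* p) (≡.sym (prodOut-outSide Q))
      (ℕP.*-cancelʳ-≤ (size T) (c ℕ.* pOut) pIn
         {{ℕ.>-nonZero (prodFin-pos M (inSide-pos n≥1 Q))}} scaled)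
    where
    pIn  = prodFin M (inSide Q)
    pOut = prodFin M (outSide Q)
    all-c : sumPts M n (λ _ → c) ≡ c ℕ.* pOut ℕ.* pIn
    all-c = begin
      sumPts M n (λ _ → c)                   ≡⟨ sumPts-const M n c ⟩
      prodFin M n ℕ.* c                      ≡⟨ cong (ℕ._* c) (prodFin-cong M (side-split Q)) ⟩
      prodFin M (λ i → inSide Q i ℕ.* outSide Q i) ℕ.* c
                                             ≡⟨ cong (ℕ._* c) (prodFin-* M (inSide Q) (outSide Q)) ⟩
      pIn ℕ.* pOut ℕ.* c                     ≡⟨ ℕP.*-comm (pIn ℕ.* pOut) c ⟩
      c ℕ.* (pIn ℕ.* pOut)                   ≡⟨ cong (c ℕ.*_) (ℕP.*-comm pIn pOut) ⟩
      c ℕ.* (pOut ℕ.* pIn)                   ≡⟨ ℕP.*-assoc c pOut pIn ⟨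
      c ℕ.* pOut ℕ.* pIn                     ∎
    scaled : size T ℕ.* pIn ℕ.≤ c ℕ.* pOut ℕ.* pIn
    scaled = ≡.subst₂ ℕ._≤_ (sum-fiberCount T Q) all-c (sumPts-mono M n fibre≤c)

  somePoint : (∀ i → 1 ℕ.≤ n i) → Point M n
  somePoint n≥1 i = Fin.fromℕ< (n≥1 i)

open Fibres

module Transversals {M : ℕ} {n : Fin M → ℕ} (n≥1 : ∀ i → 1 ℕ.≤ n i) {k : ℕ} where

  -- Parameters are bounded below by a fibre count, hence nonnegative.
  parameter-nonneg : ∀ {T L P} → IsMultiTransversal M n k T L → ∣ P ∣ ≡ k → + 0 ℤ.≤ L P
  parameter-nonneg tr |P| = ℤP.≤-trans (ℤ.+≤+ z≤n) (tr _ |P| (somePoint n≥1))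

  size-bound-ℤ : ∀ T Q (c : ℤ) → + 0 ℤ.≤ c →
                 (∀ b → + fiberCount T Q b ℤ.≤ c) → + size T ℤ.≤ c ℤ.* + prodOut n Q
  size-bound-ℤ T Q (+ c) _ fibre≤c =
    ≡.subst (+ size T ℤ.≤_) (ℤP.pos-* c (prodOut n Q))
      (ℤ.+≤+ (size-bound n≥1 T Q c (ℤP.drop‿+≤+ ∘ fibre≤c)))

  transversal-size-bound : ∀ {T L Q} → IsMultiTransversal M n k T L → ∣ Q ∣ ≡ k →
                           + size T ℤ.≤ L Q ℤ.* + prodOut n Q
  transversal-size-bound {T} {L} {Q} tr |Q| =
    size-bound-ℤ T Q (L Q) (parameter-nonneg {T} tr |Q|) (tr Q |Q|)

  full-at-minimiser : ∀ {T L A} → IsMultiTransversal M n k T L → IsFull M n k T L →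
    ∣ A ∣ ≡ k → (∀ P → ∣ P ∣ ≡ k → L A ℤ.* + prodOut n A ℤ.≤ L P ℤ.* + prodOut n P) →
    + size T ≡ L A ℤ.* + prodOut n A
  full-at-minimiser tr (P , |P| , full) |A| minimal =
    ℤP.≤-antisym (transversal-size-bound tr |A|)
                 (≡.subst (_ ℤ.≤_) (≡.sym full) (minimal P |P|))

module FloorOrderProperties {c ℓ ℓ₂} (R : CommutativeRing c ℓ) (O : FloorOrder R ℓ₂) where
  open CommutativeRing R hiding (zero) renaming (refl to ≈-refl)
  open RingOps R
  open FloorOrder O hiding (_≤_)
  open RingProperties ring using (-1*x≈-x; -‿involutive; -0#≈0#; x[y-z]≈xy-xz)
  module TO = IsTotalOrder isTotalOrder

  -- The order of O, with the usual precedence below the ring operations.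
  infix 4 _≤_
  _≤_ : Carrier → Carrier → Set ℓ₂
  _≤_ = FloorOrder._≤_ O

  poset : Poset c ℓ ℓ₂
  poset = record { isPartialOrder = TO.isPartialOrder }

  open import Relation.Binary.Reasoning.PartialOrder poset

  +-monoʳ-≤ : ∀ {x y} z → x ≤ y → z + x ≤ z + y
  +-monoʳ-≤ {x} {y} z x≤y = begin
    z + x ≈⟨ +-comm z x ⟩
    x + z ≤⟨ +-mono-≤ z x≤y ⟩
    y + z ≈⟨ +-comm y z ⟩
    z + y ∎

  +-mono₂-≤ : ∀ {x y u v} → x ≤ y → u ≤ v → x + u ≤ y + v
  +-mono₂-≤ {x} {y} {u} {v} x≤y u≤v = TO.trans (+-mono-≤ u x≤y) (+-monoʳ-≤ y u≤v)

  x+z-z≈x : ∀ x z → (x + z) - z ≈ x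
  x+z-z≈x x z = begin-equality
    (x + z) - z ≈⟨ +-assoc x z (- z) ⟩
    x + (z - z) ≈⟨ +-congˡ (-‿inverseʳ z) ⟩
    x + 0#      ≈⟨ +-identityʳ x ⟩
    x           ∎

  +-cancelʳ-≤ : ∀ {x y} z → x + z ≤ y + z → x ≤ y
  +-cancelʳ-≤ {x} {y} z le = begin
    x           ≈⟨ x+z-z≈x x z ⟨
    (x + z) - z ≤⟨ +-mono-≤ (- z) le ⟩
    (y + z) - z ≈⟨ x+z-z≈x y z ⟩
    y           ∎

  neg-antitone : ∀ {x y} → x ≤ y → - y ≤ - x
  neg-antitone {x} {y} x≤y = +-cancelʳ-≤ (x + y) (begin
    - y + (x + y) ≈⟨ +-congˡ (+-comm x y) ⟩
    - y + (y + x) ≈⟨ +-assoc (- y) y x ⟨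
    (- y + y) + x ≈⟨ +-congʳ (-‿inverseˡ y) ⟩
    0# + x        ≈⟨ +-identityˡ x ⟩
    x             ≤⟨ x≤y ⟩
    y             ≈⟨ +-identityˡ y ⟨
    0# + y        ≈⟨ +-congʳ (-‿inverseˡ x) ⟨
    (- x + x) + y ≈⟨ +-assoc (- x) x y ⟩
    - x + (x + y) ∎)

  -- The floor axioms exclude the zero ring.
  1≉0 : ¬ (1# ≈ 0#)
  1≉0 1≈0 = proj₂ (<-⌊⌋+1 0#) (sym image≈0)
    where
    image≈0 : fromℤ (⌊ 0# ⌋ ℤ.+ ℤ.1ℤ) ≈ 0#
    image≈0 = begin-equality
      _        ≈⟨ *-identityʳ _ ⟨
      _ * 1#   ≈⟨ *-congˡ 1≈0 ⟩
      _ * 0#   ≈⟨ zeroʳ _ ⟩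
      0#       ∎

  -- 1 is positive: otherwise -1 ≥ 0 and 1 = (-1)(-1) ≥ 0.
  0≤1 : 0# ≤ 1#
  0≤1 with TO.total 0# 1#
  ... | inj₁ 0≤1 = 0≤1
  ... | inj₂ 1≤0 = begin
    0#          ≤⟨ *-nonneg 0≤-1 0≤-1 ⟩
    - 1# * - 1# ≈⟨ -1*x≈-x (- 1#) ⟩
    - - 1#      ≈⟨ -‿involutive 1# ⟩
    1#          ∎
    where
    0≤-1 : 0# ≤ - 1#
    0≤-1 = begin
      0#   ≈⟨ -0#≈0# ⟨
      - 0# ≤⟨ neg-antitone 1≤0 ⟩
      - 1# ∎

  *-monoˡ-≤ : ∀ {a x y} → 0# ≤ a → x ≤ y → a * x ≤ a * y
  *-monoˡ-≤ {a} {x} {y} 0≤a x≤y = begin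
    a * x                 ≈⟨ +-identityˡ (a * x) ⟨
    0# + a * x            ≤⟨ +-mono-≤ (a * x) (*-nonneg 0≤a 0≤y-x) ⟩
    a * (y - x) + a * x   ≈⟨ +-congʳ (x[y-z]≈xy-xz a y x) ⟩
    (a * y - a * x) + a * x ≈⟨ +-assoc (a * y) (- (a * x)) (a * x) ⟩
    a * y + (- (a * x) + a * x) ≈⟨ +-congˡ (-‿inverseˡ (a * x)) ⟩
    a * y + 0#            ≈⟨ +-identityʳ (a * y) ⟩
    a * y                 ∎
    where
    0≤y-x : 0# ≤ y - x
    0≤y-x = begin
      0#    ≈⟨ -‿inverseʳ x ⟨
      x - x ≤⟨ +-mono-≤ (- x) x≤y ⟩
      y - x ∎

  *-monoʳ-≤ : ∀ {a x y} → 0# ≤ a → x ≤ y → x * a ≤ y * a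
  *-monoʳ-≤ {a} {x} {y} 0≤a x≤y = begin
    x * a ≈⟨ *-comm x a ⟩
    a * x ≤⟨ *-monoˡ-≤ 0≤a x≤y ⟩
    a * y ≈⟨ *-comm a y ⟩
    y * a ∎

  fromℕ-nonneg : ∀ m → 0# ≤ fromℕ m
  fromℕ-nonneg zero    = TO.refl
  fromℕ-nonneg (suc m) = begin
    0#            ≤⟨ 0≤1 ⟩
    1#            ≈⟨ +-identityʳ 1# ⟨
    1# + 0#       ≤⟨ +-monoʳ-≤ 1# (fromℕ-nonneg m) ⟩
    1# + fromℕ m  ∎

  fromℕ-mono : ∀ {a b} → a ℕ.≤ b → fromℕ a ≤ fromℕ b
  fromℕ-mono {b = b} z≤n  = fromℕ-nonneg b
  fromℕ-mono (ℕ.s≤s a≤b)  = +-monoʳ-≤ 1# (fromℕ-mono a≤b)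

  fromℕ-+ : ∀ a b → fromℕ (a ℕ.+ b) ≈ fromℕ a + fromℕ b
  fromℕ-+ zero    b = sym (+-identityˡ _)
  fromℕ-+ (suc a) b = trans (+-congˡ (fromℕ-+ a b)) (sym (+-assoc _ _ _))

  fromℕ-* : ∀ a b → fromℕ (a ℕ.* b) ≈ fromℕ a * fromℕ b
  fromℕ-* zero    b = sym (zeroˡ _)
  fromℕ-* (suc a) b = begin-equality
    fromℕ (b ℕ.+ a ℕ.* b)              ≈⟨ fromℕ-+ b (a ℕ.* b) ⟩
    fromℕ b + fromℕ (a ℕ.* b)          ≈⟨ +-cong (sym (*-identityˡ _)) (fromℕ-* a b) ⟩
    1# * fromℕ b + fromℕ a * fromℕ b   ≈⟨ distribʳ _ _ _ ⟨
    (1# + fromℕ a) * fromℕ b           ∎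

  fromℕ-reflect : ∀ {a b} → fromℕ a ≤ fromℕ b → a ℕ.≤ b
  fromℕ-reflect {a} {b} fa≤fb with a ℕ.≤? b
  ... | yes a≤b = a≤b
  ... | no  a≰b = ⊥-elim (1≉0 (TO.antisym 1≤0 0≤1))
    where
    1≤0 : 1# ≤ 0#
    1≤0 = +-cancelʳ-≤ (fromℕ b) (begin
      1# + fromℕ b ≤⟨ fromℕ-mono (ℕP.≰⇒> a≰b) ⟩
      fromℕ a      ≤⟨ fa≤fb ⟩
      fromℕ b      ≈⟨ +-identityˡ _ ⟨
      0# + fromℕ b ∎)

  fromℤ-mono : ∀ {i j} → i ℤ.≤ j → fromℤ i ≤ fromℤ j
  fromℤ-mono (ℤ.+≤+ m≤n)       = fromℕ-mono m≤n
  fromℤ-mono (ℤ.-≤- n≤m)       = neg-antitone (fromℕ-mono (ℕ.s≤s n≤m))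
  fromℤ-mono (ℤ.-≤+ {m} {n})   = begin
    - fromℕ (suc m) ≤⟨ neg-antitone (fromℕ-nonneg (suc m)) ⟩
    - 0#            ≈⟨ -0#≈0# ⟩
    0#              ≤⟨ fromℕ-nonneg n ⟩
    fromℕ n         ∎

  fromℤ-*-nonneg : ∀ {i} p → + 0 ℤ.≤ i → fromℤ (i ℤ.* + p) ≈ fromℤ i * fromℕ p
  fromℤ-*-nonneg {+ f} p _ = begin-equality
    fromℤ (+ f ℤ.* + p) ≡⟨ cong fromℤ (ℤP.pos-* f p) ⟨
    fromℕ (f ℕ.* p)     ≈⟨ fromℕ-* f p ⟩
    fromℕ f * fromℕ p   ∎

  floor-greatest : ∀ N x → fromℤ N ≤ x → N ℤ.≤ ⌊ x ⌋
  floor-greatest N x N≤x with N ℤ.≤? ⌊ x ⌋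
  ... | yes N≤⌊x⌋ = N≤⌊x⌋
  ... | no  N≰⌊x⌋ = ⊥-elim (proj₂ (<-⌊⌋+1 x) (TO.antisym (proj₁ (<-⌊⌋+1 x)) ⌊x⌋+1≤x))
    where
    ⌊x⌋+1≤N : ⌊ x ⌋ ℤ.+ ℤ.1ℤ ℤ.≤ N
    ⌊x⌋+1≤N = ≡.subst (ℤ._≤ N) (ℤP.+-comm ℤ.1ℤ ⌊ x ⌋)
                      (ℤP.i<j⇒suc[i]≤j (ℤP.≰⇒> N≰⌊x⌋))
    ⌊x⌋+1≤x : fromℤ (⌊ x ⌋ ℤ.+ ℤ.1ℤ) ≤ x
    ⌊x⌋+1≤x = TO.trans (fromℤ-mono ⌊x⌋+1≤N) N≤x

  integral-sandwich : ∀ {i : ℤ} {s p : ℕ} → + 0 ℤ.≤ i →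
    + s ℤ.≤ i ℤ.* + p → fromℤ i * fromℕ p ≤ fromℕ s → + s ≡ i ℤ.* + p
  integral-sandwich {+ f} {s} {p} _ s≤fp fp≤s =
    ℤP.≤-antisym s≤fp (≡.subst (ℤ._≤ + s) (ℤP.pos-* f p) (ℤ.+≤+ (fromℕ-reflect (begin
      fromℕ (f ℕ.* p)   ≈⟨ fromℕ-* f p ⟩
      fromℕ f * fromℕ p ≤⟨ fp≤s ⟩
      fromℕ s           ∎))))

  sumR-cong : ∀ j {f g : Fin j → Carrier} → (∀ l → f l ≈ g l) → sumR j f ≈ sumR j g
  sumR-cong zero    f≈g = ≈-refl
  sumR-cong (suc j) f≈g = +-cong (f≈g Fin.zero) (sumR-cong j (f≈g ∘ Fin.suc))

  sumR-+ : ∀ j (f g : Fin j → Carrier) → sumR j (λ l → f l + g l) ≈ sumR j f + sumR j g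
  sumR-+ zero    f g = sym (+-identityˡ 0#)
  sumR-+ (suc j) f g =
    trans (+-congˡ (sumR-+ j (f ∘ Fin.suc) (g ∘ Fin.suc)))
          (CommutativeSemigroupProperties.interchange +-commutativeSemigroup
             (f Fin.zero) (g Fin.zero) _ _)

  sumR-*ʳ : ∀ j a (f : Fin j → Carrier) → sumR j (λ l → f l * a) ≈ sumR j f * a
  sumR-*ʳ zero    a f = sym (zeroˡ a)
  sumR-*ʳ (suc j) a f = trans (+-congˡ (sumR-*ʳ j a (f ∘ Fin.suc))) (sym (distribʳ a _ _))

  sumR-mono : ∀ j {f g : Fin j → Carrier} → (∀ l → f l ≤ g l) → sumR j f ≤ sumR j g
  sumR-mono zero    f≤g = TO.refl
  sumR-mono (suc j) f≤g = +-mono₂-≤ (f≤g Fin.zero) (sumR-mono j (f≤g ∘ Fin.suc))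

module Combinations {c ℓ ℓ₂} (R : CommutativeRing c ℓ) (O : FloorOrder R ℓ₂)
                    {j : ℕ} (α : Fin j → CommutativeRing.Carrier R) where
  open CommutativeRing R hiding (zero) renaming (refl to ≈-refl)
  open RingOps R
  open FloorOrder O hiding (_≤_)
  open FloorOrderProperties R O
  open import Relation.Binary.Reasoning.PartialOrder poset

  IsCombination : {X : Set} → (X → ℕ) → (Fin j → X → ℕ) → Set ℓ
  IsCombination a b = ∀ x → fromℕ (a x) ≈ sumR j (λ l → α l * fromℕ (b l x))

  combinedParameter : ∀ {M} → (Fin j → Subset M → ℤ) → Subset M → Carrier
  combinedParameter L P = sumR j (λ l → α l * fromℤ (L l P))

  combination-*ʳ : ∀ {X : Set} {a : X → ℕ} {b : Fin j → X → ℕ} →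
    IsCombination a b → (w : X → ℕ) → IsCombination (λ x → a x ℕ.* w x) (λ l x → b l x ℕ.* w x)
  combination-*ʳ {a = a} {b} comb w x = begin-equality
    fromℕ (a x ℕ.* w x)                               ≈⟨ fromℕ-* (a x) (w x) ⟩
    fromℕ (a x) * fromℕ (w x)                         ≈⟨ *-congʳ (comb x) ⟩
    sumR j (λ l → α l * fromℕ (b l x)) * fromℕ (w x)  ≈⟨ sumR-*ʳ j _ _ ⟨
    sumR j (λ l → α l * fromℕ (b l x) * fromℕ (w x))  ≈⟨ sumR-cong j regroup ⟩
    sumR j (λ l → α l * fromℕ (b l x ℕ.* w x))        ∎
    where
    regroup : ∀ l → α l * fromℕ (b l x) * fromℕ (w x) ≈ α l * fromℕ (b l x ℕ.* w x)
    regroup l = trans (*-assoc _ _ _) (*-congˡ (sym (fromℕ-* (b l x) (w x))))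

  combination-sumFin : ∀ m {a : Fin m → ℕ} {b : Fin j → Fin m → ℕ} → IsCombination a b →
    fromℕ (sumFin m a) ≈ sumR j (λ l → α l * fromℕ (sumFin m (b l)))
  combination-sumFin zero    comb =
    sym (trans (sumR-cong j (λ l → zeroʳ (α l))) (zero-sum j))
    where
    zero-sum : ∀ j′ → sumR j′ (λ _ → 0#) ≈ 0#
    zero-sum zero     = ≈-refl
    zero-sum (suc j′) = trans (+-identityˡ _) (zero-sum j′)
  combination-sumFin (suc m) {a} {b} comb = begin-equality
    fromℕ (a Fin.zero ℕ.+ sumFin m (a ∘ Fin.suc))
      ≈⟨ fromℕ-+ (a Fin.zero) _ ⟩
    fromℕ (a Fin.zero) + fromℕ (sumFin m (a ∘ Fin.suc))
      ≈⟨ +-cong (comb Fin.zero) (combination-sumFin m (comb ∘ Fin.suc)) ⟩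
    sumR j (λ l → α l * fromℕ (b l Fin.zero)) + sumR j (λ l → α l * fromℕ (sumFin m (b l ∘ Fin.suc)))
      ≈⟨ sumR-+ j _ _ ⟨
    sumR j (λ l → α l * fromℕ (b l Fin.zero) + α l * fromℕ (sumFin m (b l ∘ Fin.suc)))
      ≈⟨ sumR-cong j collect ⟩
    sumR j (λ l → α l * fromℕ (sumFin (suc m) (b l))) ∎
    where
    collect : ∀ l → α l * fromℕ (b l Fin.zero) + α l * fromℕ (sumFin m (b l ∘ Fin.suc))
                  ≈ α l * fromℕ (sumFin (suc m) (b l))
    collect l = trans (sym (distribˡ (α l) _ _))
                      (*-congˡ (sym (fromℕ-+ (b l Fin.zero) (sumFin m (b l ∘ Fin.suc)))))

  combination-sumPts : ∀ M (n : Fin M → ℕ) {a : Point M n → ℕ} {b : Fin j → Point M n → ℕ} →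
    IsCombination a b → fromℕ (sumPts M n a) ≈ sumR j (λ l → α l * fromℕ (sumPts M n (b l)))
  combination-sumPts zero    n comb = comb _
  combination-sumPts (suc M) n comb =
    combination-sumFin (n Fin.zero) (λ x → combination-sumPts M (n ∘ Fin.suc) (λ v → comb _))

  combination-fiberCount : ∀ {M} {n : Fin M → ℕ} {Ts : Multiset M n} {T : Fin j → Multiset M n} →
    IsCombination Ts T → ∀ Q → IsCombination (fiberCount Ts Q) (λ l → fiberCount (T l) Q)
  combination-fiberCount {M} {n} {Ts} {T} comb Q b = begin-equality
    fromℕ (fiberCount Ts Q b)
      ≡⟨ cong fromℕ (fiberCount-weighted Ts Q b) ⟩
    fromℕ (sumPts M n (λ v → Ts v ℕ.* fibreWeight Q b v))
      ≈⟨ combination-sumPts M n (combination-*ʳ {a = Ts} {b = T} comb (fibreWeight Q b)) ⟩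
    sumR j (λ l → α l * fromℕ (sumPts M n (λ v → T l v ℕ.* fibreWeight Q b v)))
      ≈⟨ sumR-cong j (λ l → *-congˡ (reflexive (cong fromℕ (≡.sym (fiberCount-weighted (T l) Q b))))) ⟩
    sumR j (λ l → α l * fromℕ (fiberCount (T l) Q b)) ∎

  module _ {M : ℕ} {n : Fin M → ℕ} {k : ℕ} {Ts : Multiset M n}
           {T : Fin j → Multiset M n} {L : Fin j → Subset M → ℤ}
           (α≥0 : ∀ l → 0# ≤ α l) (comb : IsCombination Ts T)
           (tr : ∀ l → IsMultiTransversal M n k (T l) (L l)) where

    combination-isMultiTransversal :
      IsMultiTransversal M n k Ts (λ P → ⌊ combinedParameter L P ⌋)
    combination-isMultiTransversal Q |Q| b = floor-greatest _ _ (begin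
      fromℕ (fiberCount Ts Q b)                          ≈⟨ combination-fiberCount {Ts = Ts} {T = T} comb Q b ⟩
      sumR j (λ l → α l * fromℕ (fiberCount (T l) Q b))  ≤⟨ sumR-mono j fibre≤parameter ⟩
      combinedParameter L Q                              ∎)
      where
      fibre≤parameter : ∀ l → α l * fromℕ (fiberCount (T l) Q b) ≤ α l * fromℤ (L l Q)
      fibre≤parameter l = *-monoˡ-≤ (α≥0 l) (fromℤ-mono (tr l Q |Q| b))

    combination-full : (n≥1 : ∀ i → 1 ℕ.≤ n i) → (∀ l → IsFull M n k (T l) (L l)) →
      ∀ {A} → ∣ A ∣ ≡ k →
      (∀ l P → ∣ P ∣ ≡ k → L l A ℤ.* + prodOut n A ℤ.≤ L l P ℤ.* + prodOut n P) →
      IsFull M n k Ts (λ P → ⌊ combinedParameter L P ⌋)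
    combination-full n≥1 full {A} |A| minimal =
      A , |A| , integral-sandwich (parameter-nonneg {T = Ts} tr⋆ |A|)
                              (transversal-size-bound {T = Ts} tr⋆ |A|) floor≤size
      where
      open Transversals n≥1
      tr⋆ = combination-isMultiTransversal
      p   = prodOut n A
      X   = combinedParameter L A

      summand-size : ∀ l → fromℕ (size (T l)) ≈ fromℤ (L l A) * fromℕ p
      summand-size l = begin-equality
        fromℤ (+ size (T l))     ≡⟨ cong fromℤ (full-at-minimiser (tr l) (full l) |A| (minimal l)) ⟩
        fromℤ (L l A ℤ.* + p)    ≈⟨ fromℤ-*-nonneg p (parameter-nonneg {T = T l} (tr l) |A|) ⟩
        fromℤ (L l A) * fromℕ p  ∎

      combined-size : fromℕ (size Ts) ≈ X * fromℕ p
      combined-size = begin-equality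
        fromℕ (size Ts)                                   ≈⟨ combination-sumPts M n comb ⟩
        sumR j (λ l → α l * fromℕ (size (T l)))           ≈⟨ sumR-cong j (λ l → *-congˡ (summand-size l)) ⟩
        sumR j (λ l → α l * (fromℤ (L l A) * fromℕ p))    ≈⟨ sumR-cong j (λ l → *-assoc _ _ _) ⟨
        sumR j (λ l → α l * fromℤ (L l A) * fromℕ p)      ≈⟨ sumR-*ʳ j (fromℕ p) _ ⟩
        X * fromℕ p                                       ∎

      floor≤size : fromℤ ⌊ X ⌋ * fromℕ p ≤ fromℕ (size Ts)
      floor≤size = begin
        fromℤ ⌊ X ⌋ * fromℕ p ≤⟨ *-monoʳ-≤ (fromℕ-nonneg p) (⌊⌋-≤ X) ⟩
        X * fromℕ p           ≈⟨ combined-size ⟨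
        fromℕ (size Ts)       ∎

proposition7p8 : ∀ {c ℓ ℓ₂ : Level} (R : CommutativeRing c ℓ) (O : FloorOrder R ℓ₂) →
    let open CommutativeRing R hiding (zero)
        open RingOps R
        open FloorOrder O
    in
    (M : ℕ) (n : Fin M → ℕ) → (∀ i → 1 ℕ.≤ n i) →
    (k : ℕ) → 1 ℕ.≤ k → k ℕ.≤ M →
    (j : ℕ) → 1 ℕ.≤ j →
    (T : Fin j → Multiset M n) (L : Fin j → Subset M → ℤ) →
    (∀ l → IsMultiTransversal M n k (T l) (L l)) →
    (α : Fin j → Carrier) → (∀ l → 0# < α l) →
    (Tstar : Multiset M n) →
    (∀ v → fromℕ (Tstar v) ≈ sumR j (λ l → α l * fromℕ (T l v))) →
    IsMultiTransversal M n k Tstar (λ P → ⌊ sumR j (λ l → α l * fromℤ (L l P)) ⌋)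
    × ((∀ l → IsFull M n k (T l) (L l)) →
       (A : Subset M) → ∣ A ∣ ≡ k →
       (∀ l (P : Subset M) → ∣ P ∣ ≡ k →
          L l A ℤ.* (+ prodOut n A) ℤ.≤ L l P ℤ.* (+ prodOut n P)) →
       IsFull M n k Tstar (λ P → ⌊ sumR j (λ l → α l * fromℤ (L l P)) ⌋))
proposition7p8 R O M n n≥1 k _ _ j _ T L tr α α>0 Tstar comb =
    combination-isMultiTransversal {k = k} {Ts = Tstar} {T = T} α≥0 comb tr
  , λ full A |A| minimal → combination-full {k = k} {Ts = Tstar} {T = T} α≥0 comb tr n≥1 full |A| minimal
  where
  open Combinations R O α
  -- Only nonnegativity of the coefficients is needed.
  α≥0 : ∀ l → FloorOrder._≤_ O (CommutativeRing.0# R) (α l)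
  α≥0 l = proj₁ (α>0 l)
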